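{- Every bag of every refined tree-decomposition of a graph $G$ is unbreakable in $G$.
   Context: A tree-decomposition $(B_x:x\in V(T))$ is normal if $B_x\not\subseteq B_y$ for every edge $xy\in E(T)$. A tree-decomposition $\mathcal{D}'$ of $G$ is a refinement of $\mathcal{D}$ if every bag of $\mathcal{D}'$ is contained in some bag of $\mathcal{D}$, and a proper refinement if moreover $\mathcal{D}$ is not a refinement of $\mathcal{D}'$. A tree-decomposition is refined if it is normal and has no proper refinement. A separation of $G$ is a pair $(A,B)$ with $A,B\subseteq V(G)$ and $G=G[A]\cup G[B]$. A separation $(A,B)$ breaks a set $S\subseteq V(G)$ if $S\setminus A\ne\emptyset$, $S\setminus B\ne\emptyset$ and $A\cap B\subseteq S$. $S$ is breakable if some separation breaks it, and unbreakable otherwise. -}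

module Defs where

open import Data.Nat using (ℕ; _≤_)
open import Data.Fin using (Fin)
open import Data.Fin.Subset using (Subset; _∈_; _∉_; _⊆_)
open import Data.List using (List; []; _∷_; _++_; length)
open import Data.List.Relation.Unary.Unique.Propositional using (Unique)
open import Data.Product using (Σ; ∃; _×_)
open import Data.Sum using (_⊎_)
open import Data.Unit using (⊤)
open import Data.Empty using (⊥)
open import Relation.Nullary using (¬_)

record Graph : Set₁ where
  field
    n     : ℕ
    E     : Fin n → Fin n → Set
    E-sym : ∀ {u v} → E u v → E v u
    E-irr : ∀ {u} → ¬ E u u
open Graph public

module _ {V : Set} where
  data Walk (R : V → V → Set) : V → V → Set where
    here : ∀ {x} → Walk R x x
    step : ∀ {x y z} → R x y → Walk R y z → Walk R x z

  Chain : (R : V → V → Set) → List V → Set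
  Chain R []           = ⊤
  Chain R (x ∷ [])     = ⊤
  Chain R (x ∷ y ∷ l)  = R x y × Chain R (y ∷ l)

  Cycle : (R : V → V → Set) → Set
  Cycle R = Σ V λ x → Σ (List V) λ l →
    (2 ≤ length l) × Unique (x ∷ l) × Chain R (x ∷ (l ++ (x ∷ [])))

record TreeDecomposition (G : Graph) : Set₁ where
  field
    m          : ℕ
    TE         : Fin m → Fin m → Set
    TE-sym     : ∀ {x y} → TE x y → TE y x
    TE-irr     : ∀ {x} → ¬ TE x x
    T-nonempty : Fin m
    T-conn     : ∀ x y → Walk TE x y
    T-acyclic  : ¬ Cycle TE
    bag        : Fin m → Subset (n G)
    cover-v    : ∀ v → ∃ λ x → v ∈ bag x
    cover-e    : ∀ u v → E G u v → ∃ λ x → (u ∈ bag x × v ∈ bag x)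
    coherent   : ∀ v x y → v ∈ bag x → v ∈ bag y →
                 Walk (λ a b → v ∈ bag a × v ∈ bag b × TE a b) x y
open TreeDecomposition public

module _ {G : Graph} where
  Normal : TreeDecomposition G → Set
  Normal D = ∀ x y → TE D x y → ¬ (bag D x ⊆ bag D y)

  IsRefinement : TreeDecomposition G → TreeDecomposition G → Set
  IsRefinement D' D = ∀ x' → ∃ λ x → bag D' x' ⊆ bag D x

  IsProperRefinement : TreeDecomposition G → TreeDecomposition G → Set
  IsProperRefinement D' D = IsRefinement D' D × ¬ IsRefinement D D'

  Refined : TreeDecomposition G → Set₁
  Refined D = Normal D × ¬ (Σ (TreeDecomposition G) λ D' → IsProperRefinement D' D)

record Separation (G : Graph) : Set where
  field
    A     : Subset (n G)
    B     : Subset (n G)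
    cover : ∀ v → v ∈ A ⊎ v ∈ B
    edges : ∀ u v → E G u v → (u ∈ A × v ∈ A) ⊎ (u ∈ B × v ∈ B)
open Separation public

module _ {G : Graph} where
  Breaks : Separation G → Subset (n G) → Set
  Breaks s S = (∃ λ v → v ∈ S × v ∉ A s) × (∃ λ v → v ∈ S × v ∉ B s)
             × (∀ v → v ∈ A s → v ∈ B s → v ∈ S)

  Breakable : Subset (n G) → Set
  Breakable S = Σ (Separation G) λ s → Breaks s S

  Unbreakable : Subset (n G) → Set
  Unbreakable S = ¬ Breakable S

{-# OPTIONS --safe #-}
-- Suppose a separation (A, B) breaks the bag of a node x₀ of a tree-decomposition over T.
-- Take two copies of T joined by an edge between the two copies of x₀, and give node t
-- the bag B_t ∩ A in the first copy and B_t ∩ B in the second.  Since A ∩ B ⊆ B_x₀, a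
-- vertex occurring in both copies occurs at both copies of x₀, so this is again a
-- tree-decomposition.  Each of its bags lies in a bag of the original one, but B_x₀ lies
-- in none of its bags, since B_x₀ ⊈ A and B_x₀ ⊈ B.  So it is a proper refinement.
module Submission where

open import Defs
open import Data.Nat using (ℕ; _+_; _≤_; s≤s)
open import Data.Nat.Properties using (suc-injective)
open import Data.Fin using (Fin; splitAt; join)
open import Data.Fin.Properties using (splitAt-join; join-splitAt)
open import Data.Fin.Subset using (Subset; _∈_; _∉_; _⊆_; _∩_)
open import Data.Fin.Subset.Properties using (x∈p∩q⁺; x∈p∩q⁻)
open import Data.List using (List; []; _∷_; _++_; length; map)
open import Data.List.Properties using (map-++; length-map; ++-assoc)
open import Data.List.Relation.Unary.AllPairs using (_∷_)
open import Data.List.Relation.Unary.All.Properties using (All¬⇒¬Any)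
open import Data.List.Relation.Unary.Any using (here; there)
open import Data.List.Relation.Unary.Unique.Propositional using (Unique)
import Data.List.Relation.Unary.Unique.Propositional.Properties as Unique
import Data.List.Membership.Propositional as List
open import Data.List.Membership.Propositional.Properties using (∈-∃++)
open import Data.List.Relation.Binary.Permutation.Propositional using (_↭_; ↭⇒↭ₛ)
open import Data.List.Relation.Binary.Permutation.Propositional.Properties
  using (↭-length; ++-comm)
import Data.List.Relation.Binary.Permutation.Setoid.Properties as Permutation
open import Data.Product using (∃; _×_; _,_; proj₁; proj₂)
open import Data.Sum using (_⊎_; inj₁; inj₂; [_,_]′; reduce)
open import Data.Empty using (⊥; ⊥-elim)
open import Function using (_∘_; _on_; id)
open import Relation.Binary.Core using (_=[_]⇒_)
open import Relation.Nullary using (¬_; yes; no)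
open import Relation.Nullary.Decidable using (¬¬-excluded-middle)
open import Relation.Binary.PropositionalEquality
  using (_≡_; refl; sym; cong; subst; subst₂; setoid; module ≡-Reasoning)

-- Chosen so that Cycle R is Σ x, Σ l, IsCycle R x l on the nose.
IsCycle : {X : Set} → (X → X → Set) → X → List X → Set
IsCycle R x l = 2 ≤ length l × Unique (x ∷ l) × Chain R (x ∷ (l ++ (x ∷ [])))

module _ {X : Set} {R : X → X → Set} where

  walk-++ : ∀ {x y z} → Walk R x y → Walk R y z → Walk R x z
  walk-++ here       q = q
  walk-++ (step r p) q = step r (walk-++ p q)

  chain-++⁻ : ∀ xs {y ys} → Chain R (xs ++ y ∷ ys) → Chain R (xs ++ y ∷ []) × Chain R (y ∷ ys)
  chain-++⁻ []            c       = _ , c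
  chain-++⁻ (x ∷ [])      (r , c) = (r , _) , c
  chain-++⁻ (x ∷ x′ ∷ xs) (r , c) with chain-++⁻ (x′ ∷ xs) c
  ... | c₁ , c₂ = (r , c₁) , c₂

  chain-++⁺ : ∀ xs {y ys} → Chain R (xs ++ y ∷ []) → Chain R (y ∷ ys) → Chain R (xs ++ y ∷ ys)
  chain-++⁺ []            _        c = c
  chain-++⁺ (x ∷ [])      (r , _)  c = r , c
  chain-++⁺ (x ∷ x′ ∷ xs) (r , c₁) c = r , chain-++⁺ (x′ ∷ xs) c₁ c

  chain-init : ∀ xs {y} → Chain R (xs ++ y ∷ []) → Chain R xs
  chain-init []            _       = _
  chain-init (x ∷ [])      _       = _
  chain-init (x ∷ x′ ∷ xs) (r , c) = r , chain-init (x′ ∷ xs) c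

  isCycle-rotate : ∀ {v w l} → w List.∈ v ∷ l → IsCycle R v l → ∃ λ l′ → IsCycle R w l′
  isCycle-rotate w∈ c with ∈-∃++ w∈
  isCycle-rotate w∈ c | [] , l , refl = l , c
  isCycle-rotate {v} {w} w∈ (len , u , ch) | v ∷ p , zs , refl =
    zs ++ v ∷ p , subst (2 ≤_) (suc-injective (↭-length rotation)) len
    , Permutation.Unique-resp-↭ (setoid X) (↭⇒↭ₛ rotation) u , rotated
    where
    rotation : v ∷ p ++ w ∷ zs ↭ w ∷ zs ++ v ∷ p
    rotation = ++-comm (v ∷ p) (w ∷ zs)

    halves : Chain R (v ∷ p ++ w ∷ []) × Chain R (w ∷ zs ++ v ∷ [])
    halves = chain-++⁻ (v ∷ p) (subst (Chain R ∘ (v ∷_)) (++-assoc p (w ∷ zs) (v ∷ [])) ch)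

    rotated : Chain R (w ∷ (zs ++ v ∷ p) ++ w ∷ [])
    rotated = subst (Chain R ∘ (w ∷_)) (sym (++-assoc zs (v ∷ p) (w ∷ [])))
                (chain-++⁺ (w ∷ zs) (proj₂ halves) (proj₁ halves))

  walk-map : ∀ {Z : Set} {S : Z → Z → Set} (f : X → Z) → R =[ f ]⇒ S →
             ∀ {x y} → Walk R x y → Walk S (f x) (f y)
  walk-map f h here       = here
  walk-map f h (step r p) = step (h r) (walk-map f h p)

module _ {X Z : Set} {S : Z → Z → Set} (f : X → Z) where

  chain-map⁺ : ∀ xs → Chain (S on f) xs → Chain S (map f xs)
  chain-map⁺ []            _       = _
  chain-map⁺ (x ∷ [])      _       = _
  chain-map⁺ (x ∷ x′ ∷ xs) (r , c) = r , chain-map⁺ (x′ ∷ xs) c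

  chain-map⁻ : ∀ xs → Chain S (map f xs) → Chain (S on f) xs
  chain-map⁻ []            _       = _
  chain-map⁻ (x ∷ [])      _       = _
  chain-map⁻ (x ∷ x′ ∷ xs) (r , c) = r , chain-map⁻ (x′ ∷ xs) c

  isCycle-map⁺ : (∀ {x y} → f x ≡ f y → x ≡ y) →
                 ∀ {x l} → IsCycle (S on f) x l → IsCycle S (f x) (map f l)
  isCycle-map⁺ f-inj {x} {l} (len , u , ch) =
    subst (2 ≤_) (sym (length-map f l)) len , Unique.map⁺ f-inj u
    , subst (Chain S ∘ (f x ∷_)) (map-++ f l (x ∷ [])) (chain-map⁺ (x ∷ l ++ x ∷ []) ch)

  isCycle-map⁻ : ∀ {x l} → IsCycle S (f x) (map f l) → IsCycle (S on f) x l
  isCycle-map⁻ {x} {l} (len , u , ch) =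
    subst (2 ≤_) (length-map f l) len , Unique.map⁻ u
    , chain-map⁻ (x ∷ l ++ x ∷ []) (subst (Chain S ∘ (f x ∷_)) (sym (map-++ f l (x ∷ []))) ch)

Carrying : {X : Set} {k : ℕ} → (X → X → Set) → (X → Subset k) → Fin k → X → X → Set
Carrying R β v p q = v ∈ β p × v ∈ β q × R p q

Coherent : {X : Set} {k : ℕ} → (X → X → Set) → (X → Subset k) → Set
Coherent R β = ∀ v x y → v ∈ β x → v ∈ β y → Walk (Carrying R β v) x y

coherent-∩ : ∀ {X : Set} {k} {R : X → X → Set} {β : X → Subset k} →
             Coherent R β → (P : Subset k) → Coherent R (λ x → β x ∩ P)
coherent-∩ coh P v x y vx vy =
  walk-map id (λ (vx′ , vy′ , r) → x∈p∩q⁺ (vx′ , vP) , x∈p∩q⁺ (vy′ , vP) , r)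
    (coh v x y (proj₁ (x∈p∩q⁻ _ _ vx)) (proj₁ (x∈p∩q⁻ _ _ vy)))
  where vP = proj₂ (x∈p∩q⁻ _ P vx)

module Glue {X Y : Set} (R : X → X → Set) (S : Y → Y → Set) (a : X) (b : Y) where

  Glued : X ⊎ Y → X ⊎ Y → Set
  Glued (inj₁ x) (inj₁ x′) = R x x′
  Glued (inj₂ y) (inj₂ y′) = S y y′
  Glued (inj₁ x) (inj₂ y)  = x ≡ a × y ≡ b
  Glued (inj₂ y) (inj₁ x)  = x ≡ a × y ≡ b

  glued-sym : (∀ {x x′} → R x x′ → R x′ x) → (∀ {y y′} → S y y′ → S y′ y) →
              ∀ {p q} → Glued p q → Glued q p
  glued-sym R-sym S-sym {inj₁ _} {inj₁ _} r = R-sym r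
  glued-sym R-sym S-sym {inj₂ _} {inj₂ _} s = S-sym s
  glued-sym R-sym S-sym {inj₁ _} {inj₂ _} e = e
  glued-sym R-sym S-sym {inj₂ _} {inj₁ _} e = e

  glued-irr : (∀ {x} → ¬ R x x) → (∀ {y} → ¬ S y y) → ∀ {p} → ¬ Glued p p
  glued-irr R-irr S-irr {inj₁ _} = R-irr
  glued-irr R-irr S-irr {inj₂ _} = S-irr

  glued-connected : (∀ x x′ → Walk R x x′) → (∀ y y′ → Walk S y y′) → ∀ p q → Walk Glued p q
  glued-connected R-conn S-conn (inj₁ x) (inj₁ x′) = walk-map inj₁ id (R-conn x x′)
  glued-connected R-conn S-conn (inj₂ y) (inj₂ y′) = walk-map inj₂ id (S-conn y y′)
  glued-connected R-conn S-conn (inj₁ x) (inj₂ y)  =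
    walk-++ (walk-map inj₁ id (R-conn x a)) (step (refl , refl) (walk-map inj₂ id (S-conn b y)))
  glued-connected R-conn S-conn (inj₂ y) (inj₁ x)  =
    walk-++ (walk-map inj₂ id (S-conn y b)) (step (refl , refl) (walk-map inj₁ id (R-conn a x)))

  glued-coherent : ∀ {k} {β : X → Subset k} {γ : Y → Subset k} → Coherent R β → Coherent S γ →
                   (∀ {v x y} → v ∈ β x → v ∈ γ y → v ∈ β a × v ∈ γ b) →
                   Coherent Glued [ β , γ ]′
  glued-coherent β-coh γ-coh shared v (inj₁ x) (inj₁ x′) vx vx′ = walk-map inj₁ id (β-coh v x x′ vx vx′)
  glued-coherent β-coh γ-coh shared v (inj₂ y) (inj₂ y′) vy vy′ = walk-map inj₂ id (γ-coh v y y′ vy vy′)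
  glued-coherent β-coh γ-coh shared v (inj₁ x) (inj₂ y)  vx vy  =
    let va , vb = shared vx vy in
    walk-++ (walk-map inj₁ id (β-coh v x a vx va))
            (step (va , vb , refl , refl) (walk-map inj₂ id (γ-coh v b y vb vy)))
  glued-coherent β-coh γ-coh shared v (inj₂ y) (inj₁ x)  vy vx  =
    let va , vb = shared vx vy in
    walk-++ (walk-map inj₂ id (γ-coh v y b vy vb))
            (step (vb , va , refl , refl) (walk-map inj₁ id (β-coh v a x va vx)))

  one-sided : ∀ zs → Chain Glued zs → inj₂ b List.∉ zs →
              (∃ λ xs → zs ≡ map inj₁ xs) ⊎ (∃ λ ys → zs ≡ map inj₂ ys)
  one-sided []            _       _  = inj₁ ([] , refl)
  one-sided (inj₁ x ∷ []) _       _  = inj₁ (x ∷ [] , refl)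
  one-sided (inj₂ y ∷ []) _       _  = inj₂ (y ∷ [] , refl)
  one-sided (z ∷ z′ ∷ zs) (e , c) b∉ with one-sided (z′ ∷ zs) c (b∉ ∘ there)
  one-sided (inj₁ x ∷ _) _ _ | inj₁ (x′ ∷ xs , refl) = inj₁ (x ∷ x′ ∷ xs , refl)
  one-sided (inj₂ y ∷ _) _ _ | inj₂ (y′ ∷ ys , refl) = inj₂ (y ∷ y′ ∷ ys , refl)
  one-sided (inj₂ y ∷ _) ((_ , y≡b) , _) b∉ | inj₁ (_ ∷ _ , refl) =
    ⊥-elim (b∉ (here (cong inj₂ (sym y≡b))))
  one-sided (inj₁ x ∷ _) ((_ , y′≡b) , _) b∉ | inj₂ (_ ∷ _ , refl) =
    ⊥-elim (b∉ (there (here (cong inj₂ (sym y′≡b)))))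

  -- Both glueing edges end at inj₂ b, so a cycle avoiding it stays on one side.  A cycle
  -- through it, rotated to start there, either stays on the S side or enters the R side
  -- through inj₁ a and has to come back through inj₁ a, visiting it twice.
  module _ (R-acyclic : ¬ Cycle R) (S-acyclic : ¬ Cycle S) where

    avoiding-b : ∀ {v l} → IsCycle Glued v l → inj₂ b List.∉ v ∷ l → ⊥
    avoiding-b {v} {l} c@(_ , _ , ch) b∉ with one-sided (v ∷ l) (chain-init (v ∷ l) ch) b∉
    ... | inj₁ (x ∷ xs , refl) = R-acyclic (x , xs , isCycle-map⁻ inj₁ c)
    ... | inj₂ (y ∷ ys , refl) = S-acyclic (y , ys , isCycle-map⁻ inj₂ c)

    exits-at-a : ∀ x xs → Chain Glued (map inj₁ (x ∷ xs) ++ inj₂ b ∷ []) → a List.∈ x ∷ xs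
    exits-at-a x []        ((x≡a , _) , _) = here (sym x≡a)
    exits-at-a x (x′ ∷ xs) (_ , c)         = there (exits-at-a x′ xs c)

    through-b : ∀ {l} → IsCycle Glued (inj₂ b) l → ⊥
    through-b {y ∷ ys} c@(_ , b∉ ∷ _ , _ , ch)
      with one-sided (y ∷ ys) (chain-init (y ∷ ys) ch) (All¬⇒¬Any b∉)
    through-b c | inj₂ (y ∷ ys , refl) = S-acyclic (b , y ∷ ys , isCycle-map⁻ inj₂ c)
    through-b (s≤s () , _) | inj₁ (x ∷ [] , refl)
    through-b (_ , _ ∷ u , (x≡a , _) , _ , ch) | inj₁ (x ∷ x′ ∷ xs , refl)
      with Unique.map⁻ {f = inj₁} u
    ... | x-fresh ∷ _ = All¬⇒¬Any x-fresh (subst (List._∈ x′ ∷ xs) (sym x≡a) (exits-at-a x′ xs ch))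

    glued-acyclic : ¬ Cycle Glued
    -- The goal is ⊥, so deciding whether inj₂ b lies on the cycle needs no decidable equality.
    glued-acyclic (v , l , c) = ¬¬-excluded-middle λ where
      (no b∉)  → avoiding-b c b∉
      (yes b∈) → through-b (proj₂ (isCycle-rotate b∈ c))

module Reindex {X : Set} {k : ℕ} (f : Fin k → X) (g : X → Fin k)
               (f∘g : ∀ x → f (g x) ≡ x) (g∘f : ∀ i → g (f i) ≡ i) where

  f-injective : ∀ {i j} → f i ≡ f j → i ≡ j
  f-injective {i} {j} e = begin
    i         ≡⟨ sym (g∘f i) ⟩
    g (f i)   ≡⟨ cong g e ⟩
    g (f j)   ≡⟨ g∘f j ⟩
    j         ∎
    where open ≡-Reasoning

  walk-reindex : ∀ {R : X → X → Set} {i j} → Walk R (f i) (f j) → Walk (R on f) i j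
  walk-reindex {R} {i} {j} w =
    subst₂ (Walk (R on f)) (g∘f i) (g∘f j) (walk-map g (subst₂ R (sym (f∘g _)) (sym (f∘g _))) w)

  acyclic-reindex : ∀ {R : X → X → Set} → ¬ Cycle R → ¬ Cycle (R on f)
  acyclic-reindex acyclic (i , l , c) = acyclic (f i , map f l , isCycle-map⁺ f f-injective c)

  coherent-reindex : ∀ {k′} {R : X → X → Set} {β : X → Subset k′} → Coherent R β → Coherent (R on f) (β ∘ f)
  coherent-reindex coh v i j vi vj = walk-reindex (coh v (f i) (f j) vi vj)

  ∃-reindex : ∀ {P : X → Set} → ∃ P → ∃ (P ∘ f)
  ∃-reindex {P} (x , p) = g x , subst P (sym (f∘g x)) p

module Split {G : Graph} (D : TreeDecomposition G) (s : Separation G) (x₀ : Fin (m D))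
             (separator⊆ : ∀ v → v ∈ A s → v ∈ B s → v ∈ bag D x₀) where

  open Glue (TE D) (TE D) x₀ x₀
  open Reindex (splitAt (m D)) (join (m D) (m D)) (splitAt-join (m D) (m D)) (join-splitAt (m D) (m D))

  split-bag : Fin (m D) ⊎ Fin (m D) → Subset (n G)
  split-bag = [ (λ x → bag D x ∩ A s) , (λ x → bag D x ∩ B s) ]′

  split-bag-covers-vertices : ∀ v → ∃ λ p → v ∈ split-bag p
  split-bag-covers-vertices v with cover-v D v | cover s v
  ... | x , vx | inj₁ vA = inj₁ x , x∈p∩q⁺ (vx , vA)
  ... | x , vx | inj₂ vB = inj₂ x , x∈p∩q⁺ (vx , vB)

  split-bag-covers-edges : ∀ u v → E G u v → ∃ λ p → u ∈ split-bag p × v ∈ split-bag p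
  split-bag-covers-edges u v uv with cover-e D u v uv | edges s u v uv
  ... | x , ux , vx | inj₁ (uA , vA) = inj₁ x , x∈p∩q⁺ (ux , uA) , x∈p∩q⁺ (vx , vA)
  ... | x , ux , vx | inj₂ (uB , vB) = inj₂ x , x∈p∩q⁺ (ux , uB) , x∈p∩q⁺ (vx , vB)

  split-bag-coherent : Coherent Glued split-bag
  split-bag-coherent =
    glued-coherent (coherent-∩ (coherent D) (A s)) (coherent-∩ (coherent D) (B s)) at-x₀
    where
    at-x₀ : ∀ {v x y} → v ∈ bag D x ∩ A s → v ∈ bag D y ∩ B s → v ∈ bag D x₀ ∩ A s × v ∈ bag D x₀ ∩ B s
    at-x₀ {v} vxA vyB = x∈p∩q⁺ (vx₀ , vA) , x∈p∩q⁺ (vx₀ , vB)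
      where
      vA = proj₂ (x∈p∩q⁻ _ _ vxA)
      vB = proj₂ (x∈p∩q⁻ _ _ vyB)
      vx₀ = separator⊆ v vA vB

  split : TreeDecomposition G
  split = record
    { m          = m D + m D
    ; TE         = Glued on splitAt (m D)
    ; TE-sym     = λ {i j} → glued-sym (TE-sym D) (TE-sym D) {splitAt (m D) i} {splitAt (m D) j}
    ; TE-irr     = λ {i} → glued-irr (TE-irr D) (TE-irr D) {splitAt (m D) i}
    ; T-nonempty = join (m D) (m D) (inj₁ x₀)
    ; T-conn     = λ i j → walk-reindex (glued-connected (T-conn D) (T-conn D) _ _)
    ; T-acyclic  = acyclic-reindex (glued-acyclic (T-acyclic D) (T-acyclic D))
    ; bag        = split-bag ∘ splitAt (m D)
    ; cover-v    = ∃-reindex ∘ split-bag-covers-vertices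
    ; cover-e    = λ u v uv → ∃-reindex (split-bag-covers-edges u v uv)
    ; coherent   = coherent-reindex split-bag-coherent
    }

  split-bag⊆bag : ∀ p → split-bag p ⊆ bag D (reduce p)
  split-bag⊆bag (inj₁ x) = proj₁ ∘ x∈p∩q⁻ _ _
  split-bag⊆bag (inj₂ x) = proj₁ ∘ x∈p∩q⁻ _ _

  bag⊈split-bag : (∃ λ v → v ∈ bag D x₀ × v ∉ A s) → (∃ λ v → v ∈ bag D x₀ × v ∉ B s) →
                  ∀ p → ¬ bag D x₀ ⊆ split-bag p
  bag⊈split-bag (v , vx₀ , v∉A) _ (inj₁ x) ⊆ = v∉A (proj₂ (x∈p∩q⁻ _ _ (⊆ vx₀)))
  bag⊈split-bag _ (v , vx₀ , v∉B) (inj₂ x) ⊆ = v∉B (proj₂ (x∈p∩q⁻ _ _ (⊆ vx₀)))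

  split-refines : IsRefinement split D
  split-refines i = reduce (splitAt (m D) i) , split-bag⊆bag (splitAt (m D) i)

  split-not-refined : (∃ λ v → v ∈ bag D x₀ × v ∉ A s) → (∃ λ v → v ∈ bag D x₀ × v ∉ B s) →
                      ¬ IsRefinement D split
  split-not-refined ∉A ∉B refines =
    bag⊈split-bag ∉A ∉B (splitAt (m D) (proj₁ (refines x₀))) (proj₂ (refines x₀))

lemma8 : (G : Graph) (D : TreeDecomposition G) → Refined D →
    ∀ x → Unbreakable {G} (bag D x)
lemma8 G D (_ , no-proper-refinement) x (s , ∉A , ∉B , separator⊆) =
  no-proper-refinement (split , split-refines , split-not-refined ∉A ∉B)
  where open Split D s x separator⊆
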